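{- Let $\mathcal{C}$ be a category, $F\colon\mathcal{C}\to\mathcal{C}$ a functor, $I$ an object of $\mathcal{C}$, and $\mathcal{M}$ a class of morphisms of $\mathcal{C}$. (1) If every split monomorphism of $\mathcal{C}$ lies in $\mathcal{M}$, then every pointed $F$-coalgebra that is a tree is $\mathcal{M}$-reachably unfolded. (2) If every pointed $F$-coalgebra has some $\mathcal{M}$-reachable $\mathcal{M}$-subcoalgebra, then every $\mathcal{M}$-reachably unfolded pointed $F$-coalgebra is a tree (and in particular is also $\mathcal{M}$-reachable).
   Context: A pointed $F$-coalgebra is $(C,c,i_C)$ with $c\colon C\to FC$, $i_C\colon I\to C$; a pointed coalgebra morphism $h\colon(T,t,i_T)\to(C,c,i_C)$ is $h\colon T\to C$ with $c\cdot h=Fh\cdot t$ and $h\cdot i_T=i_C$. A split epimorphism of pointed coalgebras is a pointed coalgebra morphism $h$ for which there is a pointed coalgebra morphism $s$ with $h\cdot s=\mathrm{id}$. An $\mathcal{M}$-subcoalgebra of $(C,c,i_C)$ is a pointed coalgebra morphism into it whose underlying morphism is in $\mathcal{M}$. $(C,c,i_C)$ is $\mathcal{M}$-reachable if each of its $\mathcal{M}$-subcoalgebras is a split epimorphism of pointed coalgebras; it is a tree if every pointed coalgebra morphism into it is a split epimorphism of pointed coalgebras; it is $\mathcal{M}$-reachably unfolded if every pointed coalgebra morphism $h\colon R\to C$ from an $\mathcal{M}$-reachable pointed coalgebra $R$ is an isomorphism. -}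

module Defs where

open import Level using (Level; _⊔_; suc)
open import Relation.Binary using (Rel; IsEquivalence)
open import Data.Product using (Σ; _×_; _,_)

record Category (o ℓ e : Level) : Set (suc (o ⊔ ℓ ⊔ e)) where
  infix  4 _≈_
  infixr 9 _∘_
  field
    Obj : Set o
    _⇒_ : Obj → Obj → Set ℓ
    _≈_ : ∀ {A B} → Rel (A ⇒ B) e
    id  : ∀ {A} → A ⇒ A
    _∘_ : ∀ {A B C} → B ⇒ C → A ⇒ B → A ⇒ C
    assoc     : ∀ {A B C D} {f : A ⇒ B} {g : B ⇒ C} {h : C ⇒ D} →
                (h ∘ g) ∘ f ≈ h ∘ (g ∘ f)
    identityˡ : ∀ {A B} {f : A ⇒ B} → id ∘ f ≈ f
    identityʳ : ∀ {A B} {f : A ⇒ B} → f ∘ id ≈ f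
    equiv     : ∀ {A B} → IsEquivalence (_≈_ {A} {B})
    ∘-resp-≈  : ∀ {A B C} {f h : B ⇒ C} {g i : A ⇒ B} →
                f ≈ h → g ≈ i → f ∘ g ≈ h ∘ i

record Endofunctor {o ℓ e} (C : Category o ℓ e) : Set (o ⊔ ℓ ⊔ e) where
  open Category C
  field
    F₀ : Obj → Obj
    F₁ : ∀ {A B} → A ⇒ B → F₀ A ⇒ F₀ B
    identity     : ∀ {A} → F₁ (id {A}) ≈ id
    homomorphism : ∀ {X Y Z} {f : X ⇒ Y} {g : Y ⇒ Z} →
                   F₁ (g ∘ f) ≈ F₁ g ∘ F₁ f
    F-resp-≈     : ∀ {A B} {f g : A ⇒ B} → f ≈ g → F₁ f ≈ F₁ g

MorClass : ∀ {o ℓ e} (C : Category o ℓ e) (ℓm : Level) → Set (o ⊔ ℓ ⊔ suc ℓm)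
MorClass C ℓm = ∀ {A B} → Category._⇒_ C A B → Set ℓm

module Coalg {o ℓ e} (C : Category o ℓ e) (F : Endofunctor C) (I : Category.Obj C) where
  open Category C
  open Endofunctor F

  IsSplitMono : ∀ {A B} → A ⇒ B → Set (ℓ ⊔ e)
  IsSplitMono {A} {B} m = Σ (B ⇒ A) λ r → r ∘ m ≈ id

  isomorphism : ∀ {A B} → A ⇒ B → Set (ℓ ⊔ e)
  isomorphism {A} {B} f = Σ (B ⇒ A) λ g → (g ∘ f ≈ id) × (f ∘ g ≈ id)

  record PointedCoalgebra : Set (o ⊔ ℓ) where
    constructor pcoalg
    field
      carrier : Obj
      str     : carrier ⇒ F₀ carrier
      point   : I ⇒ carrier
  open PointedCoalgebra public

  record PHom (T C′ : PointedCoalgebra) : Set (ℓ ⊔ e) where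
    constructor phom
    field
      mor      : carrier T ⇒ carrier C′
      commutes : str C′ ∘ mor ≈ F₁ mor ∘ str T
      preserves-point : mor ∘ point T ≈ point C′
  open PHom public

  IsSplitEpiP : ∀ {T C′} → PHom T C′ → Set (ℓ ⊔ e)
  IsSplitEpiP {T} {C′} h = Σ (PHom C′ T) λ s → mor h ∘ mor s ≈ id

  record MSub {ℓm} (M : MorClass C ℓm) (C′ : PointedCoalgebra) : Set (o ⊔ ℓ ⊔ e ⊔ ℓm) where
    constructor msub
    field
      dom  : PointedCoalgebra
      incl : PHom dom C′
      inM  : M (mor incl)

  IsMReachable : ∀ {ℓm} → MorClass C ℓm → PointedCoalgebra → Set (o ⊔ ℓ ⊔ e ⊔ ℓm)
  IsMReachable M C′ = ∀ (S : MSub M C′) → IsSplitEpiP (MSub.incl S)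

  IsTree : PointedCoalgebra → Set (o ⊔ ℓ ⊔ e)
  IsTree C′ = ∀ (T : PointedCoalgebra) (h : PHom T C′) → IsSplitEpiP h

  IsMReachablyUnfolded : ∀ {ℓm} → MorClass C ℓm → PointedCoalgebra → Set (o ⊔ ℓ ⊔ e ⊔ ℓm)
  IsMReachablyUnfolded M C′ =
    ∀ (R : PointedCoalgebra) → IsMReachable M R → (h : PHom R C′) → isomorphism (mor h)

{-# OPTIONS --safe #-}
-- Part (1): the section s of h : R → X that the tree X provides has retraction h, so it is an
-- M-subcoalgebra of R; reachability of R splits it as well, so s is invertible and h is its inverse.
-- Part (2): for h : T → X, compose h with an M-reachable M-subcoalgebra i : R → T; unfoldedness
-- makes h ∘ i invertible, its inverse is again a coalgebra morphism, and i after that inverse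
-- is a section of h.
module Submission where

open import Defs
open import Data.Product using (Σ; _×_; _,_)
open import Relation.Binary using (Setoid; IsEquivalence)
import Relation.Binary.Reasoning.Setoid as SetoidReasoning

module CategoryProperties {o ℓ e} (C : Category o ℓ e) where
  open Category C

  hom-setoid : Obj → Obj → Setoid ℓ e
  hom-setoid A B = record { Carrier = A ⇒ B ; _≈_ = _≈_ ; isEquivalence = equiv }

  module _ {A B : Obj} where
    open IsEquivalence (equiv {A} {B}) public
      renaming (refl to ≈-refl; sym to ≈-sym; trans to ≈-trans)
    open SetoidReasoning (hom-setoid A B) public

  ∘-resp-≈ˡ : ∀ {A B D} {f : B ⇒ D} {g h : A ⇒ B} → g ≈ h → f ∘ g ≈ f ∘ h
  ∘-resp-≈ˡ = ∘-resp-≈ ≈-refl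

  ∘-resp-≈ʳ : ∀ {A B D} {f g : B ⇒ D} {h : A ⇒ B} → f ≈ g → f ∘ h ≈ g ∘ h
  ∘-resp-≈ʳ p = ∘-resp-≈ p ≈-refl

  left-inverse≈right-inverse : ∀ {A B} {h t : A ⇒ B} {s : B ⇒ A} →
    h ∘ s ≈ id → s ∘ t ≈ id → h ≈ t
  left-inverse≈right-inverse {h = h} {t} {s} hs≈id st≈id = begin
    h             ≈⟨ ≈-sym identityʳ ⟩
    h ∘ id        ≈⟨ ∘-resp-≈ˡ (≈-sym st≈id) ⟩
    h ∘ (s ∘ t)   ≈⟨ ≈-sym assoc ⟩
    (h ∘ s) ∘ t   ≈⟨ ∘-resp-≈ʳ hs≈id ⟩
    id ∘ t        ≈⟨ identityˡ ⟩
    t             ∎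

module PointedCoalgebraProperties {o ℓ e} (C : Category o ℓ e) (F : Endofunctor C)
    (I : Category.Obj C) where
  open Category C
  open Endofunctor F
  open Coalg C F I
  open CategoryProperties C

  F-resp-retraction : ∀ {A B} {f : A ⇒ B} {g : B ⇒ A} → g ∘ f ≈ id → F₁ g ∘ F₁ f ≈ id
  F-resp-retraction gf≈id = ≈-trans (≈-sym homomorphism) (≈-trans (F-resp-≈ gf≈id) identity)

  infixr 9 _∘ᴾ_

  _∘ᴾ_ : ∀ {X Y Z} → PHom Y Z → PHom X Y → PHom X Z
  _∘ᴾ_ {X} {Y} {Z} g f = phom (mor g ∘ mor f) commutes-∘ (≈-trans assoc points-∘)
    where
    commutes-∘ : str Z ∘ (mor g ∘ mor f) ≈ F₁ (mor g ∘ mor f) ∘ str X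
    commutes-∘ = begin
      str Z ∘ (mor g ∘ mor f)             ≈⟨ ≈-sym assoc ⟩
      (str Z ∘ mor g) ∘ mor f             ≈⟨ ∘-resp-≈ʳ (commutes g) ⟩
      (F₁ (mor g) ∘ str Y) ∘ mor f        ≈⟨ assoc ⟩
      F₁ (mor g) ∘ (str Y ∘ mor f)        ≈⟨ ∘-resp-≈ˡ (commutes f) ⟩
      F₁ (mor g) ∘ (F₁ (mor f) ∘ str X)   ≈⟨ ≈-sym assoc ⟩
      (F₁ (mor g) ∘ F₁ (mor f)) ∘ str X   ≈⟨ ∘-resp-≈ʳ (≈-sym homomorphism) ⟩
      F₁ (mor g ∘ mor f) ∘ str X          ∎

    points-∘ : mor g ∘ (mor f ∘ point X) ≈ point Z
    points-∘ = ≈-trans (∘-resp-≈ˡ (preserves-point f)) (preserves-point g)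

  inverseᴾ : ∀ {R X} (k : PHom R X) {g : carrier X ⇒ carrier R} →
    g ∘ mor k ≈ id → mor k ∘ g ≈ id → PHom X R
  inverseᴾ {R} {X} k {g} gk≈id kg≈id = phom g commutes-g points-g
    where
    commutes-g : str R ∘ g ≈ F₁ g ∘ str X
    commutes-g = begin
      str R ∘ g                             ≈⟨ ≈-sym identityˡ ⟩
      id ∘ (str R ∘ g)                      ≈⟨ ∘-resp-≈ʳ (≈-sym (F-resp-retraction gk≈id)) ⟩
      (F₁ g ∘ F₁ (mor k)) ∘ (str R ∘ g)     ≈⟨ assoc ⟩
      F₁ g ∘ (F₁ (mor k) ∘ (str R ∘ g))     ≈⟨ ∘-resp-≈ˡ (≈-sym assoc) ⟩
      F₁ g ∘ ((F₁ (mor k) ∘ str R) ∘ g)     ≈⟨ ∘-resp-≈ˡ (∘-resp-≈ʳ (≈-sym (commutes k))) ⟩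
      F₁ g ∘ ((str X ∘ mor k) ∘ g)          ≈⟨ ∘-resp-≈ˡ assoc ⟩
      F₁ g ∘ (str X ∘ (mor k ∘ g))          ≈⟨ ∘-resp-≈ˡ (∘-resp-≈ˡ kg≈id) ⟩
      F₁ g ∘ (str X ∘ id)                   ≈⟨ ∘-resp-≈ˡ identityʳ ⟩
      F₁ g ∘ str X                          ∎

    points-g : g ∘ point X ≈ point R
    points-g = begin
      g ∘ point X               ≈⟨ ∘-resp-≈ˡ (≈-sym (preserves-point k)) ⟩
      g ∘ (mor k ∘ point R)     ≈⟨ ≈-sym assoc ⟩
      (g ∘ mor k) ∘ point R     ≈⟨ ∘-resp-≈ʳ gk≈id ⟩
      id ∘ point R              ≈⟨ identityˡ ⟩
      point R                   ∎

  tree⇒reachable : ∀ {ℓm} (M : MorClass C ℓm) {X} → IsTree X → IsMReachable M X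
  tree⇒reachable M tree S = tree (MSub.dom S) (MSub.incl S)

  tree⇒reachably-unfolded : ∀ {ℓm} (M : MorClass C ℓm) →
    (∀ {A B} (m : A ⇒ B) → IsSplitMono m → M m) →
    ∀ {X} → IsTree X → IsMReachablyUnfolded M X
  tree⇒reachably-unfolded M splitMono⇒M {X} tree R reachable h =
    mor s , ≈-trans (∘-resp-≈ˡ h≈t) st≈id , hs≈id
    where
    open Σ (tree R h) renaming (proj₁ to s; proj₂ to hs≈id)
    open Σ (reachable (msub X s (splitMono⇒M (mor s) (mor h , hs≈id))))
      renaming (proj₁ to t; proj₂ to st≈id)

    h≈t : mor h ≈ mor t
    h≈t = left-inverse≈right-inverse hs≈id st≈id

  reachably-unfolded⇒tree : ∀ {ℓm} (M : MorClass C ℓm) →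
    (∀ X → Σ (MSub M X) λ S → IsMReachable M (MSub.dom S)) →
    ∀ {X} → IsMReachablyUnfolded M X → IsTree X
  reachably-unfolded⇒tree M reachable-sub unfolded T h =
    i ∘ᴾ inverseᴾ (h ∘ᴾ i) gk≈id kg≈id , ≈-trans (≈-sym assoc) kg≈id
    where
    open Σ (reachable-sub T) renaming (proj₁ to S; proj₂ to reachable)
    open MSub S using () renaming (incl to i)
    open Σ (unfolded (MSub.dom S) reachable (h ∘ᴾ i))
      renaming (proj₁ to g; proj₂ to inverse)
    open Σ inverse renaming (proj₁ to gk≈id; proj₂ to kg≈id)

theorem5p5 : ∀ {o ℓ e ℓm} (C : Category o ℓ e) (F : Endofunctor C) (I : Category.Obj C)
    (M : MorClass C ℓm) →
    let open Coalg C F I in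
    ((∀ {A B} (m : Category._⇒_ C A B) → IsSplitMono m → M m) →
      ∀ (X : PointedCoalgebra) → IsTree X → IsMReachablyUnfolded M X)
    ×
    ((∀ (X : PointedCoalgebra) → Σ (MSub M X) λ S → IsMReachable M (MSub.dom S)) →
      ∀ (X : PointedCoalgebra) → IsMReachablyUnfolded M X → IsTree X × IsMReachable M X)
theorem5p5 C F I M =
    (λ splitMono⇒M X → tree⇒reachably-unfolded M splitMono⇒M)
  , (λ reachable-sub X unfolded →
       let tree = reachably-unfolded⇒tree M reachable-sub unfolded
       in tree , tree⇒reachable M tree)
  where open PointedCoalgebraProperties C F I
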